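{- For all DIBI formulas $P,Q$, the sequent $P*Q\vdash P\triangleright Q$ is derivable in the DIBI Hilbert system.
   Context: DIBI formulas over atoms $\mathcal{AP}$: $P,Q ::= p \mid \top \mid I \mid \bot \mid P\wedge Q \mid P\vee Q \mid P\to Q \mid P * Q \mid P \mathrel{ -\!\!*} Q \mid P \triangleright Q \mid P \multimap_r Q \mid P \multimap_l Q$. The DIBI Hilbert system derives sequents $P\vdash Q$ by the rules (premises $\Rightarrow$ conclusion): $P\vdash P$; $P\vdash\top$; $\bot\vdash P$; $P\vdash R, Q\vdash R\Rightarrow P\vee Q\vdash R$; $P\vdash Q_i\Rightarrow P\vdash Q_1\vee Q_2$; $P\vdash Q, P\vdash R\Rightarrow P\vdash Q\wedge R$; $Q\vdash R\Rightarrow P\wedge Q\vdash R$; $P\vdash Q_1\wedge Q_2\Rightarrow P\vdash Q_i$; $P\wedge Q\vdash R\Rightarrow P\vdash Q\to R$; $P\vdash Q\to R, P\vdash Q\Rightarrow P\vdash R$; $P*Q\vdash R\Rightarrow P\vdash Q\mathrel{ -\!\!*}R$; $P\vdash Q\mathrel{ -\!\!*}R, S\vdash Q\Rightarrow P*S\vdash R$; $P\triangleright Q\vdash R\Rightarrow P\vdash Q\multimap_r R$; $P\vdash Q\multimap_r R, S\vdash Q\Rightarrow P\triangleright S\vdash R$; $P\triangleright Q\vdash R\Rightarrow Q\vdash P\multimap_l R$; $P\vdash Q\multimap_l R, S\vdash Q\Rightarrow S\triangleright P\vdash R$; $P\vdash P*I$, $P*I\vdash P$; $P\vdash R, Q\vdash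 S\Rightarrow P*Q\vdash R*S$; $P*Q\vdash Q*P$; $(P*Q)*R\vdash P*(Q*R)$ and converse; $P\vdash I\triangleright P$; $P\vdash R, Q\vdash S\Rightarrow P\triangleright Q\vdash R\triangleright S$; $P\vdash P\triangleright I$, $P\triangleright I\vdash P$; $(P\triangleright Q)\triangleright R\vdash P\triangleright(Q\triangleright R)$ and converse; $(P\triangleright Q)*(R\triangleright S)\vdash(P*R)\triangleright(Q*S)$. -}

module Defs where

open import Level using (Level)

data Formula {a : Level} (AP : Set a) : Set a where
  atom : AP → Formula AP
  ⊤ᶠ   : Formula AP
  Iᶠ   : Formula AP
  ⊥ᶠ   : Formula AP
  _∧_  : Formula AP → Formula AP → Formula AP
  _∨_  : Formula AP → Formula AP → Formula AP
  _⇒_  : Formula AP → Formula AP → Formula AP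
  _✱_  : Formula AP → Formula AP → Formula AP
  _-✱_ : Formula AP → Formula AP → Formula AP
  _▷_  : Formula AP → Formula AP → Formula AP
  _⊸r_ : Formula AP → Formula AP → Formula AP
  _⊸l_ : Formula AP → Formula AP → Formula AP

infixr 30 _✱_ _▷_
infixr 25 _∧_
infixr 24 _∨_
infixr 20 _⇒_ _-✱_ _⊸r_ _⊸l_
infix 10 _⊢_

data _⊢_ {a : Level} {AP : Set a} : Formula AP → Formula AP → Set a where
  ax      : ∀ {P} → P ⊢ P
  ⊤-intro : ∀ {P} → P ⊢ ⊤ᶠ
  ⊥-elim  : ∀ {P} → ⊥ᶠ ⊢ P
  ∨-elim  : ∀ {P Q R} → P ⊢ R → Q ⊢ R → (P ∨ Q) ⊢ R
  ∨-intro₁ : ∀ {P Q₁ Q₂} → P ⊢ Q₁ → P ⊢ (Q₁ ∨ Q₂)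
  ∨-intro₂ : ∀ {P Q₁ Q₂} → P ⊢ Q₂ → P ⊢ (Q₁ ∨ Q₂)
  ∧-intro : ∀ {P Q R} → P ⊢ Q → P ⊢ R → P ⊢ (Q ∧ R)
  ∧-weak  : ∀ {P Q R} → Q ⊢ R → (P ∧ Q) ⊢ R
  ∧-elim₁ : ∀ {P Q₁ Q₂} → P ⊢ (Q₁ ∧ Q₂) → P ⊢ Q₁
  ∧-elim₂ : ∀ {P Q₁ Q₂} → P ⊢ (Q₁ ∧ Q₂) → P ⊢ Q₂
  ⇒-intro : ∀ {P Q R} → (P ∧ Q) ⊢ R → P ⊢ (Q ⇒ R)
  ⇒-elim  : ∀ {P Q R} → P ⊢ (Q ⇒ R) → P ⊢ Q → P ⊢ R
  -✱-intro : ∀ {P Q R} → (P ✱ Q) ⊢ R → P ⊢ (Q -✱ R)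
  -✱-elim  : ∀ {P Q R S} → P ⊢ (Q -✱ R) → S ⊢ Q → (P ✱ S) ⊢ R
  ⊸r-intro : ∀ {P Q R} → (P ▷ Q) ⊢ R → P ⊢ (Q ⊸r R)
  ⊸r-elim  : ∀ {P Q R S} → P ⊢ (Q ⊸r R) → S ⊢ Q → (P ▷ S) ⊢ R
  ⊸l-intro : ∀ {P Q R} → (P ▷ Q) ⊢ R → Q ⊢ (P ⊸l R)
  ⊸l-elim  : ∀ {P Q R S} → P ⊢ (Q ⊸l R) → S ⊢ Q → (S ▷ P) ⊢ R
  ✱-unit₁ : ∀ {P} → P ⊢ (P ✱ Iᶠ)
  ✱-unit₂ : ∀ {P} → (P ✱ Iᶠ) ⊢ P
  ✱-conj  : ∀ {P Q R S} → P ⊢ R → Q ⊢ S → (P ✱ Q) ⊢ (R ✱ S)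
  ✱-comm  : ∀ {P Q} → (P ✱ Q) ⊢ (Q ✱ P)
  ✱-assoc₁ : ∀ {P Q R} → ((P ✱ Q) ✱ R) ⊢ (P ✱ (Q ✱ R))
  ✱-assoc₂ : ∀ {P Q R} → (P ✱ (Q ✱ R)) ⊢ ((P ✱ Q) ✱ R)
  ▷-left-unit : ∀ {P} → P ⊢ (Iᶠ ▷ P)
  ▷-conj  : ∀ {P Q R S} → P ⊢ R → Q ⊢ S → (P ▷ Q) ⊢ (R ▷ S)
  ▷-unit₁ : ∀ {P} → P ⊢ (P ▷ Iᶠ)
  ▷-unit₂ : ∀ {P} → (P ▷ Iᶠ) ⊢ P
  ▷-assoc₁ : ∀ {P Q R} → ((P ▷ Q) ▷ R) ⊢ (P ▷ (Q ▷ R))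
  ▷-assoc₂ : ∀ {P Q R} → (P ▷ (Q ▷ R)) ⊢ ((P ▷ Q) ▷ R)
  rev-exchange : ∀ {P Q R S} → ((P ▷ Q) ✱ (R ▷ S)) ⊢ ((P ✱ R) ▷ (Q ✱ S))

module Submission where

open import Level using (Level)
open import Defs

-- P ✱ Q ⊢ (P ▷ I) ✱ (I ▷ Q) ⊢ (P ✱ I) ▷ (I ✱ Q) ⊢ P ▷ Q: pad with ▷-units,
-- apply reverse exchange, and absorb the units on the ✱ side.

-- Cut is not a rule of the system; it is admissible through implication.
⊢-trans : ∀ {a} {AP : Set a} {P Q R : Formula AP} → P ⊢ Q → Q ⊢ R → P ⊢ R
⊢-trans P⊢Q Q⊢R = ⇒-elim (⇒-intro (∧-weak Q⊢R)) P⊢Q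

✱-unitˡ : ∀ {a} {AP : Set a} {P : Formula AP} → (Iᶠ ✱ P) ⊢ P
✱-unitˡ = ⊢-trans ✱-comm ✱-unit₂

mainTheorem7 : {a : Level} {AP : Set a} (P Q : Formula AP) → (P ✱ Q) ⊢ (P ▷ Q)
mainTheorem7 P Q =
  ⊢-trans (✱-conj ▷-unit₁ ▷-left-unit)
    (⊢-trans rev-exchange
      (▷-conj ✱-unit₂ ✱-unitˡ))
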